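{- Let $F$ be a CNF formula, $(T,\delta)$ a decomposition tree of $I(F)$, and let $x,y,z$ be nodes of $T$ such that $x$ and $y$ are the children of $z$. Let $\tau\in2^{\mathrm{var}_z}$ be of shape $(\mathit{out}_z,\mathit{in}_z)$ (a shape for $z$), and let $\tau_x$ and $\tau_y$ be the restrictions of $\tau$ to $\mathrm{var}_x$ and $\mathrm{var}_y$, respectively. Then there are unique shapes $(\mathit{out}_x,\mathit{in}_x)$ for $x$ and $(\mathit{out}_y,\mathit{in}_y)$ for $y$ which generate $(\mathit{out}_z,\mathit{in}_z)$ and such that $\tau_x$ has shape $(\mathit{out}_x,\mathit{in}_x)$ and $\tau_y$ has shape $(\mathit{out}_y,\mathit{in}_y)$.
   Context: A clause is a finite set of literals (variables $x$ or negations $\bar x$) not containing both $x$ and $\bar x$; a CNF formula $F$ is a finite set of clauses; $\mathrm{var}(C)$, $\mathrm{var}(F)$ denote occurring variables. The incidence graph $I(F)$ has vertex set $\mathrm{var}(F)\cup F$ and edges $Cx$ for $x\in\mathrm{var}(C)$. A decomposition tree of a graph is a pair $(T,\delta)$ with $T$ a rooted binary tree and $\delta$ a bijection from the leaves of $T$ to the vertex set. For a set of variables $X$, $2^X$ is the set of maps $\sigma:X\to\{0,1\}$ ($\sigma(\bar x)=1-\sigma(x)$); $\sigma$ satisfies clause $C$ if $\sigma(\ell)=1$ for some $\ell\in C$ with variable in $X$. For a set of clauses $G$, $G(\sigma)$ is the set of clauses of $G$ satisfied by $\sigma$. For a node $z$ of $T$ let $T_z$ be the subtree rooted at $z$ with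 leaf set $L(T_z)$; $\mathrm{var}_z=\mathrm{var}(F)\cap\delta(L(T_z))$, $F_z=F\cap\delta(L(T_z))$, $\overline{F_z}=F\setminus F_z$. A shape for $z$ is a pair $(\mathit{out},\mathit{in})$ with $\mathit{out}\subseteq\overline{F_z}$, $\mathit{in}\subseteq F_z$. An assignment $\tau\in2^{\mathrm{var}_z}$ is of shape $(\mathit{out},\mathit{in})$ if (i) $\overline{F_z}(\tau)=\mathit{out}$ and (ii) every clause $C\in F_z$ is satisfied by $\tau$ or belongs to $\mathit{in}$. If $x,y$ are the children of $z$, shapes $(\mathit{out}_x,\mathit{in}_x)$ for $x$ and $(\mathit{out}_y,\mathit{in}_y)$ for $y$ generate the shape $(\mathit{out}_z,\mathit{in}_z)$ for $z$ if (1) $\mathit{out}_z=(\mathit{out}_x\cup\mathit{out}_y)\cap\overline{F_z}$, (2) $\mathit{in}_x=(\mathit{in}_z\cup\mathit{out}_y)\cap F_x$, and (3) $\mathit{in}_y=(\mathit{in}_z\cup\mathit{out}_x)\cap F_y$. -}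

module Defs where

open import Data.Bool using (Bool; true; false; T)
open import Data.Maybe using (Maybe; just; nothing)
open import Data.Nat using (ℕ)
open import Data.Unit using (⊤)
open import Data.Fin using (Fin)
open import Data.Fin.Properties renaming (_≟_ to _≟F_)
open import Data.Fin.Subset using (Subset; _∈_; _⊆_; _∪_; _∩_; ∁)
open import Data.Vec using (Vec; lookup; tabulate)
open import Data.List using (List; []; _∷_; _++_)
open import Data.List.Relation.Unary.All using (All)
open import Data.List.Relation.Unary.Unique.Propositional using (Unique)
import Data.List.Membership.Propositional as LMem
import Data.List.Membership.DecPropositional as DMem
open import Data.List.Membership.Propositional.Properties using (∈-++⁺ˡ; ∈-++⁺ʳ)
open import Data.Sum using (_⊎_; inj₁; inj₂)
open import Data.Sum.Properties using (≡-dec)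
open import Data.Product using (Σ; _×_; _,_)
open import Relation.Nullary using (¬_; isYes)
open import Relation.Nullary.Decidable using (toWitness; fromWitness)
open import Relation.Binary.PropositionalEquality using (_≡_)
open import Function.Bundles using (_⇔_)

-- A clause over n variables assigns to each variable
-- either nothing (does not occur), just true (the literal x occurs) or
-- just false (the literal x̄ occurs). Thus a clause is a finite set of
-- literals never containing both x and x̄.
Clause : ℕ → Set
Clause n = Vec (Maybe Bool) n

-- A CNF formula with m clauses: an injective family Fin m → Clause n
-- (injectivity is imposed in the statement, making it a set of clauses).
CNF : ℕ → ℕ → Set
CNF n m = Fin m → Clause n

OccursVar : ∀ {n m} → CNF n m → Fin n → Set
OccursVar F v = Σ _ λ i → ¬ (lookup (F i) v ≡ nothing)

-- Vertices of the incidence graph: variables (inj₁) and clauses (inj₂).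
Vertex : ℕ → ℕ → Set
Vertex n m = Fin n ⊎ Fin m

IsVertex : ∀ {n m} → CNF n m → Vertex n m → Set
IsVertex F (inj₁ v) = OccursVar F v
IsVertex F (inj₂ i) = ⊤

-- Rooted binary trees with leaves labelled (δ) by vertices.
data Tree (A : Set) : Set where
  leaf : A → Tree A
  node : Tree A → Tree A → Tree A

leaves : ∀ {A} → Tree A → List A
leaves (leaf a)   = a ∷ []
leaves (node l r) = leaves l ++ leaves r

-- s ≼ t : s is the subtree T_z of t rooted at some node z of t.
data _≼_ {A : Set} : Tree A → Tree A → Set where
  here  : ∀ {t} → t ≼ t
  left  : ∀ {s l r} → s ≼ l → s ≼ node l r
  right : ∀ {s l r} → s ≼ r → s ≼ node l r

-- (T, δ) is a decomposition tree of I(F): δ is a bijection from the leaves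
-- onto var(F) ∪ F (leaf labels are vertices, pairwise distinct, and every
-- vertex is a label).
IsDecompositionTree : ∀ {n m} → CNF n m → Tree (Vertex n m) → Set
IsDecompositionTree F T =
  All (IsVertex F) (leaves T) × Unique (leaves T) ×
  (∀ w → IsVertex F w → w LMem.∈ leaves T)

module _ {n m : ℕ} where
  open DMem (≡-dec (_≟F_ {n}) (_≟F_ {m})) using (_∈?_)

  -- var_z (as a Bool test): v labels a leaf of T_z. (Since all leaf labels
  -- are vertices of I(F), this is var(F) ∩ δ(L(T_z)).)
  inVar : Tree (Vertex n m) → Fin n → Bool
  inVar t v = isYes (inj₁ v ∈? leaves t)

  Fz : Tree (Vertex n m) → Subset m
  Fz t = tabulate λ i → isYes (inj₂ i ∈? leaves t)

  Assign : Tree (Vertex n m) → Set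
  Assign t = (v : Fin n) → T (inVar t v) → Bool

  -- σ satisfies C: some literal of C with variable in var_z is set to 1.
  -- (lookup C v ≡ just b means the literal of polarity b on v is in C; it is
  -- true under σ iff σ v ≡ b.)
  Sat : (t : Tree (Vertex n m)) → Assign t → Clause n → Set
  Sat t σ C = Σ (Fin n) λ v → Σ (T (inVar t v)) λ p → lookup C v ≡ just (σ v p)

  Shape : Set
  Shape = Subset m × Subset m

  IsShape : Tree (Vertex n m) → Shape → Set
  IsShape t (out , inn) = out ⊆ ∁ (Fz t) × inn ⊆ Fz t

  HasShape : CNF n m → (t : Tree (Vertex n m)) → Assign t → Shape → Set
  HasShape F t τ (out , inn) =
    (∀ i → (i ∈ out) ⇔ (i ∈ ∁ (Fz t) × Sat t τ (F i))) ×
    (∀ i → i ∈ Fz t → Sat t τ (F i) ⊎ i ∈ inn)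

  Generates : (tx ty : Tree (Vertex n m)) → Shape → Shape → Shape → Set
  Generates tx ty (outx , inx) (outy , iny) (outz , inz) =
    (outz ≡ (outx ∪ outy) ∩ ∁ (Fz (node tx ty))) ×
    (inx ≡ (inz ∪ outy) ∩ Fz tx) ×
    (iny ≡ (inz ∪ outx) ∩ Fz ty)

  private
    w→∈ : ∀ {x} {xs} → T (isYes (x ∈? xs)) → x LMem.∈ xs
    w→∈ {x} {xs} p = toWitness {a? = x ∈? xs} p
    ∈→w : ∀ {x} {xs} → x LMem.∈ xs → T (isYes (x ∈? xs))
    ∈→w {x} {xs} p = fromWitness {a? = x ∈? xs} p

  restrictˡ : (tx ty : Tree (Vertex n m)) → Assign (node tx ty) → Assign tx
  restrictˡ tx ty τ v p = τ v (∈→w {inj₁ v} {leaves (node tx ty)} (∈-++⁺ˡ (w→∈ {inj₁ v} {leaves tx} p)))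

  restrictʳ : (tx ty : Tree (Vertex n m)) → Assign (node tx ty) → Assign ty
  restrictʳ tx ty τ v p = τ v (∈→w {inj₁ v} {leaves (node tx ty)} (∈-++⁺ʳ (leaves tx) (w→∈ {inj₁ v} {leaves ty} p)))

-- The out-part of a shape of an assignment is determined by the assignment
-- alone: it must be the set of outside clauses the assignment satisfies. So
-- out_x and out_y are forced, and then the generation equations (2) and (3)
-- force in_x and in_y; this gives uniqueness. For existence take exactly these
-- sets. A clause outside F_z is satisfied by τ iff it is satisfied by τ_x or
-- by τ_y, which is equation (1). A clause of F_x is either in in_z or
-- satisfied by τ, hence by τ_x or by τ_y; in the last case it lies outside
-- F_y (leaves of T are distinct, so F_x and F_y are disjoint) and so belongs
-- to out_y ⊆ in_x.
module Submission where

open import Defs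
open import Data.Bool using (Bool; true; false; T)
open import Data.Bool.Properties using (T-irrelevant; T-≡) renaming (_≟_ to _≟B_)
open import Data.Fin using (Fin)
open import Data.Fin.Properties using (any?) renaming (_≟_ to _≟F_)
open import Data.Fin.Subset using (Subset; _∈_; _∉_; _⊆_; _∪_; _∩_; ∁)
open import Data.Fin.Subset.Properties
  using (⊆-antisym; p⊆q⇒∁p⊇∁q; x∉p⇒x∈∁p; x∈p∩q⁺; x∈p∩q⁻; p∩q⊆q;
         p⊆p∪q; q⊆p∪q; x∈p∪q⁻)
  renaming (_∈?_ to _∈ₛ?_)
open import Data.List using (List; []; _∷_; _++_)
open import Data.List.Membership.Propositional using () renaming (_∈_ to _∈ₗ_)
import Data.List.Membership.DecPropositional as DecMembership
open import Data.List.Membership.Propositional.Properties using (∈-++⁺ˡ; ∈-++⁺ʳ; ∈-++⁻)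
open import Data.List.Relation.Binary.Disjoint.Propositional using (Disjoint)
import Data.List.Relation.Unary.All as All
open import Data.List.Relation.Unary.All.Properties using (++⁻ˡ)
open import Data.List.Relation.Unary.AllPairs using ([]; _∷_)
open import Data.List.Relation.Unary.Any using (here; there)
open import Data.List.Relation.Unary.Unique.Propositional using (Unique)
import Data.Maybe.Properties as Maybe
open import Data.Maybe using (Maybe; just)
open import Data.Nat using (ℕ)
open import Data.Product using (Σ; _×_; _,_; proj₁; proj₂)
open import Data.Sum using (_⊎_; inj₁; inj₂; [_,_]′; swap)
open import Data.Sum.Properties using (≡-dec)
open import Data.Unit using (tt)
open import Data.Vec using (tabulate; lookup)
open import Data.Vec.Properties using (lookup∘tabulate; []=⇒lookup; lookup⇒[]=)
open import Function using (_∘_)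
open import Function.Bundles using (_⇔_; mk⇔; Equivalence)
open import Function.Definitions using (Injective)
open import Level using (0ℓ)
open import Relation.Binary.PropositionalEquality using (_≡_; refl; sym; trans; cong; cong₂)
open import Relation.Nullary using (Dec; yes; no; isYes)
open import Relation.Nullary.Decidable using (toWitness; fromWitness; _×-dec_)
open import Relation.Unary using (Pred; Decidable)

open Equivalence using (to; from)

subsetOf : ∀ {m} {P : Pred (Fin m) 0ℓ} → Decidable P → Subset m
subsetOf P? = tabulate λ i → isYes (P? i)

∈-subsetOf : ∀ {m} {P : Pred (Fin m) 0ℓ} (P? : Decidable P) i → i ∈ subsetOf P? ⇔ P i
∈-subsetOf P? i = mk⇔
  (λ i∈ → toWitness (from T-≡ (trans (sym (lookup∘tabulate f i)) ([]=⇒lookup i∈))))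
  (λ Pi → lookup⇒[]= i (tabulate f) (trans (lookup∘tabulate f i) (to T-≡ (fromWitness Pi))))
  where f = λ j → isYes (P? j)

Unique-++⁻ˡ : ∀ {A : Set} (xs : List A) {ys} → Unique (xs ++ ys) → Unique xs
Unique-++⁻ˡ []       _                  = []
Unique-++⁻ˡ (x ∷ xs) (x∉ ∷ xs++ys!) = ++⁻ˡ xs x∉ ∷ Unique-++⁻ˡ xs xs++ys!

Unique-++⁻ʳ : ∀ {A : Set} (xs : List A) {ys} → Unique (xs ++ ys) → Unique ys
Unique-++⁻ʳ []       ys!            = ys!
Unique-++⁻ʳ (x ∷ xs) (_ ∷ xs++ys!) = Unique-++⁻ʳ xs xs++ys!

Unique-++⇒Disjoint : ∀ {A : Set} (xs : List A) {ys} → Unique (xs ++ ys) → Disjoint xs ys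
Unique-++⇒Disjoint (x ∷ xs) (x∉ ∷ _) (here refl , v∈ys) = All.lookup x∉ (∈-++⁺ʳ xs v∈ys) refl
Unique-++⇒Disjoint (x ∷ xs) (_ ∷ xs++ys!) (there v∈xs , v∈ys) =
  Unique-++⇒Disjoint xs xs++ys! (v∈xs , v∈ys)

Unique-≼ : ∀ {A : Set} {s t : Tree A} → s ≼ t → Unique (leaves t) → Unique (leaves s)
Unique-≼ here t! = t!
Unique-≼ {t = node l r} (left s≼l) t! = Unique-≼ s≼l (Unique-++⁻ˡ (leaves l) t!)
Unique-≼ {t = node l r} (right s≼r) t! = Unique-≼ s≼r (Unique-++⁻ʳ (leaves l) t!)

Σ-T? : ∀ (b : Bool) (f : T b → Bool) (c : Maybe Bool) → Dec (Σ (T b) λ p → c ≡ just (f p))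
Σ-T? false f c = no λ ()
Σ-T? true  f c with Maybe.≡-dec _≟B_ c (just (f tt))
... | yes c≡ = yes (tt , c≡)
... | no c≢  = no λ { (tt , c≡) → c≢ c≡ }

module _ {n m : ℕ} where
  open DecMembership (≡-dec (_≟F_ {n}) (_≟F_ {m})) using (_∈?_)

  private
    VTree : Set
    VTree = Tree (Vertex n m)

  ∈-Fz : ∀ (t : VTree) i → i ∈ Fz t ⇔ inj₂ i ∈ₗ leaves t
  ∈-Fz t = ∈-subsetOf (λ i → inj₂ i ∈? leaves t)

  Fz-disjoint : ∀ (tx ty : VTree) → Unique (leaves (node tx ty)) → ∀ {i} → i ∈ Fz tx → i ∉ Fz ty
  Fz-disjoint tx ty z! {i} i∈x i∈y =
    Unique-++⇒Disjoint (leaves tx) z! (to (∈-Fz tx i) i∈x , to (∈-Fz ty i) i∈y)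

  Fz-⊆ˡ : ∀ (tx ty : VTree) → Fz tx ⊆ Fz (node tx ty)
  Fz-⊆ˡ tx ty {i} = from (∈-Fz (node tx ty) i) ∘ ∈-++⁺ˡ ∘ to (∈-Fz tx i)

  Fz-⊆ʳ : ∀ (tx ty : VTree) → Fz ty ⊆ Fz (node tx ty)
  Fz-⊆ʳ tx ty {i} = from (∈-Fz (node tx ty) i) ∘ ∈-++⁺ʳ (leaves tx) ∘ to (∈-Fz ty i)

  Sat? : ∀ (t : VTree) (σ : Assign t) C → Dec (Sat t σ C)
  Sat? t σ C = any? λ v → Σ-T? (inVar t v) (σ v) (lookup C v)

  Sat-restrictˡ : ∀ (tx ty : VTree) τ C → Sat tx (restrictˡ tx ty τ) C → Sat (node tx ty) τ C
  Sat-restrictˡ tx ty τ C (v , _ , C[v]≡) = v , _ , C[v]≡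

  Sat-restrictʳ : ∀ (tx ty : VTree) τ C → Sat ty (restrictʳ tx ty τ) C → Sat (node tx ty) τ C
  Sat-restrictʳ tx ty τ C (v , _ , C[v]≡) = v , _ , C[v]≡

  Sat-node⁻ : ∀ (tx ty : VTree) τ C → Sat (node tx ty) τ C →
    Sat tx (restrictˡ tx ty τ) C ⊎ Sat ty (restrictʳ tx ty τ) C
  Sat-node⁻ tx ty τ C (v , v∈z , C[v]≡) with ∈-++⁻ (leaves tx) (toWitness v∈z)
  ... | inj₁ v∈x = inj₁ (v , fromWitness v∈x , trans C[v]≡ (cong (just ∘ τ v) (T-irrelevant _ _)))
  ... | inj₂ v∈y = inj₂ (v , fromWitness v∈y , trans C[v]≡ (cong (just ∘ τ v) (T-irrelevant _ _)))

  satisfiedOutside : CNF n m → (t : VTree) → Assign t → Subset m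
  satisfiedOutside F t σ = subsetOf λ i → (i ∈ₛ? ∁ (Fz t)) ×-dec Sat? t σ (F i)

  ∈-satisfiedOutside : ∀ F (t : VTree) σ i → i ∈ satisfiedOutside F t σ ⇔ (i ∈ ∁ (Fz t) × Sat t σ (F i))
  ∈-satisfiedOutside F t σ = ∈-subsetOf _

  satisfiedOutside-unique : ∀ F (t : VTree) σ out →
    (∀ i → i ∈ out ⇔ (i ∈ ∁ (Fz t) × Sat t σ (F i))) → out ≡ satisfiedOutside F t σ
  satisfiedOutside-unique F t σ out out-spec = ⊆-antisym
    (λ {i} → from (∈-satisfiedOutside F t σ i) ∘ to (out-spec i))
    (λ {i} → from (out-spec i) ∘ to (∈-satisfiedOutside F t σ i))

  IsShape-satisfiedOutside : ∀ F (t : VTree) σ (inn : Subset m) →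
    IsShape t (satisfiedOutside F t σ , inn ∩ Fz t)
  IsShape-satisfiedOutside F t σ inn =
    (λ {i} → proj₁ ∘ to (∈-satisfiedOutside F t σ i)) , p∩q⊆q inn (Fz t)

  HasShape-child : ∀ F (tz tc ts : VTree) τ σc σs (inz : Subset m) →
    (∀ C → Sat tz τ C → Sat tc σc C ⊎ Sat ts σs C) →
    Fz tc ⊆ Fz tz → (∀ {i} → i ∈ Fz tc → i ∉ Fz ts) →
    (∀ i → i ∈ Fz tz → Sat tz τ (F i) ⊎ i ∈ inz) →
    HasShape F tc σc (satisfiedOutside F tc σc , (inz ∪ satisfiedOutside F ts σs) ∩ Fz tc)
  HasShape-child F tz tc ts τ σc σs inz Sat-split c⊆z c∉s inz-spec =
    ∈-satisfiedOutside F tc σc , λ i i∈c → covered i i∈c (inz-spec i (c⊆z i∈c))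
    where
    inc = (inz ∪ satisfiedOutside F ts σs) ∩ Fz tc
    covered : ∀ i → i ∈ Fz tc → Sat tz τ (F i) ⊎ i ∈ inz → Sat tc σc (F i) ⊎ i ∈ inc
    covered i i∈c (inj₂ i∈inz) = inj₂ (x∈p∩q⁺ (p⊆p∪q _ i∈inz , i∈c))
    covered i i∈c (inj₁ sat) with Sat-split (F i) sat
    ... | inj₁ sat-c = inj₁ sat-c
    ... | inj₂ sat-s = inj₂ (x∈p∩q⁺ (q⊆p∪q inz _ i∈out-s , i∈c))
      where i∈out-s = from (∈-satisfiedOutside F ts σs i) (x∉p⇒x∈∁p (c∉s i∈c) , sat-s)

  generates-out : ∀ F (tx ty : VTree) τ outz →
    (∀ i → i ∈ outz ⇔ (i ∈ ∁ (Fz (node tx ty)) × Sat (node tx ty) τ (F i))) →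
    outz ≡ (satisfiedOutside F tx (restrictˡ tx ty τ) ∪ satisfiedOutside F ty (restrictʳ tx ty τ))
             ∩ ∁ (Fz (node tx ty))
  generates-out F tx ty τ outz outz-spec = ⊆-antisym into onto
    where
    tz = node tx ty
    outx = satisfiedOutside F tx (restrictˡ tx ty τ)
    outy = satisfiedOutside F ty (restrictʳ tx ty τ)
    into : outz ⊆ (outx ∪ outy) ∩ ∁ (Fz tz)
    into {i} i∈outz with to (outz-spec i) i∈outz
    ... | i∉z , sat = x∈p∩q⁺ ([ in-outx , in-outy ]′ (Sat-node⁻ tx ty τ (F i) sat) , i∉z)
      where
      in-outx = λ sat-x → p⊆p∪q outy (from (∈-satisfiedOutside F tx _ i)
                                             (p⊆q⇒∁p⊇∁q (Fz-⊆ˡ tx ty) i∉z , sat-x))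
      in-outy = λ sat-y → q⊆p∪q outx outy (from (∈-satisfiedOutside F ty _ i)
                                                  (p⊆q⇒∁p⊇∁q (Fz-⊆ʳ tx ty) i∉z , sat-y))
    onto : (outx ∪ outy) ∩ ∁ (Fz tz) ⊆ outz
    onto {i} i∈ with x∈p∩q⁻ (outx ∪ outy) _ i∈
    ... | i∈outx∪outy , i∉z =
      from (outz-spec i) (i∉z , [ sat-x , sat-y ]′ (x∈p∪q⁻ outx outy i∈outx∪outy))
      where
      sat-x = Sat-restrictˡ tx ty τ (F i) ∘ proj₂ ∘ to (∈-satisfiedOutside F tx _ i)
      sat-y = Sat-restrictʳ tx ty τ (F i) ∘ proj₂ ∘ to (∈-satisfiedOutside F ty _ i)

lemma4 : {n m : ℕ} (F : CNF n m) → Injective _≡_ _≡_ F →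
    (T : Tree (Vertex n m)) → IsDecompositionTree F T →
    (tx ty : Tree (Vertex n m)) → node tx ty ≼ T →
    (sz : Shape {n} {m}) → IsShape (node tx ty) sz →
    (τ : Assign (node tx ty)) → HasShape F (node tx ty) τ sz →
    Σ (Shape {n} {m} × Shape {n} {m}) λ { (sx , sy) →
    (IsShape tx sx × IsShape ty sy × Generates tx ty sx sy sz ×
    HasShape F tx (restrictˡ tx ty τ) sx × HasShape F ty (restrictʳ tx ty τ) sy) ×
    (∀ sx′ sy′ → IsShape tx sx′ → IsShape ty sy′ → Generates tx ty sx′ sy′ sz →
    HasShape F tx (restrictˡ tx ty τ) sx′ → HasShape F ty (restrictʳ tx ty τ) sy′ →
    (sx′ ≡ sx) × (sy′ ≡ sy)) }
lemma4 F _ T (_ , T! , _) tx ty z≼T (outz , inz) _ τ (outz-spec , inz-spec) =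
  ((outx , inx) , (outy , iny)) ,
  ( IsShape-satisfiedOutside F tx τx (inz ∪ outy)
  , IsShape-satisfiedOutside F ty τy (inz ∪ outx)
  , (generates-out F tx ty τ outz outz-spec , refl , refl)
  , HasShape-child F tz tx ty τ τx τy inz (Sat-node⁻ tx ty τ)
      (Fz-⊆ˡ tx ty) (Fz-disjoint tx ty z!) inz-spec
  , HasShape-child F tz ty tx τ τy τx inz (λ C → swap ∘ Sat-node⁻ tx ty τ C)
      (Fz-⊆ʳ tx ty) (λ i∈y i∈x → Fz-disjoint tx ty z! i∈x i∈y) inz-spec ) ,
  unique
  where
  tz = node tx ty
  τx = restrictˡ tx ty τ
  τy = restrictʳ tx ty τ
  z! = Unique-≼ z≼T T!
  outx = satisfiedOutside F tx τx
  outy = satisfiedOutside F ty τy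
  inx = (inz ∪ outy) ∩ Fz tx
  iny = (inz ∪ outx) ∩ Fz ty
  unique : ∀ sx′ sy′ → IsShape tx sx′ → IsShape ty sy′ → Generates tx ty sx′ sy′ (outz , inz) →
    HasShape F tx τx sx′ → HasShape F ty τy sy′ → (sx′ ≡ (outx , inx)) × (sy′ ≡ (outy , iny))
  unique (outx′ , _) (outy′ , _) _ _ (_ , inx′≡ , iny′≡) (outx′-spec , _) (outy′-spec , _)
    with satisfiedOutside-unique F tx τx outx′ outx′-spec
       | satisfiedOutside-unique F ty τy outy′ outy′-spec
  ... | refl | refl = cong₂ _,_ refl inx′≡ , cong₂ _,_ refl iny′≡
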